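{- Let $i\in\mathit{Agt}$ and let $\lhd$ be either $\prec_i$ or $\prec^{\mathsf{real}}_i$. Then for all $\varphi,\psi,\varphi_1,\varphi_2,\varphi_3\in\mathcal{L}$: (1) $\models\neg(\varphi\lhd\varphi)$; (2) $\models(\psi\lhd\varphi)\rightarrow\neg(\varphi\lhd\psi)$; (3) $\models((\varphi_1\lhd\varphi_2)\wedge(\varphi_2\lhd\varphi_3))\rightarrow(\varphi_1\lhd\varphi_3)$.
   Context: Fix a countably infinite set $\mathit{Atm}$ of atoms and a finite set of agents $\mathit{Agt}=\{1,\dots,n\}$; for every $i$, $\mathit{Atm}$ contains distinguished atoms $\mathit{good}_i$, $\mathit{bad}_i$. $\mathcal{L}_0$: $\alpha ::= p \mid \neg\alpha \mid \alpha\wedge\alpha \mid \triangle_i\alpha$; usual Boolean abbreviations. A state is $S=((B_i)_{i\in\mathit{Agt}},V)$ with $B_i\subseteq\mathcal{L}_0$, $V\subseteq\mathit{Atm}$; $\mathbf{S}$ is the set of states. $S\models p$ iff $p\in V$; Boolean as usual; $S\models\triangle_i\alpha$ iff $\alpha\in B_i$. $S\,\mathcal{E}_i\,S'$ iff $S'\models\alpha$ for all $\alpha\in B_i$; $S\,\mathcal{A}_i\,S'$ iff some $\alpha$ with $(\alpha\rightarrow\mathit{good}_i)\in B_i$ has $S'\models\alpha$; $S\,\mathcal{R}_i\,S'$ iff some $\alpha$ with $(\alpha\rightarrow\mathit{bad}_i)\in B_i$ has $S'\models\alpha$. A model is $(S,U)$ with $S\in U\subseteq\mathbf{S}$. $\mathcal{L}$: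 $\varphi ::= \alpha \mid \neg\varphi\mid\varphi\wedge\varphi\mid \Box_i\varphi \mid \mathsf{A}_i\varphi\mid\mathsf{R}_i\varphi\mid\mathsf{A}^{\mathsf{real}}_i\varphi\mid\mathsf{R}^{\mathsf{real}}_i\varphi$. Semantics: $(S,U)\models\alpha$ iff $S\models\alpha$; Boolean as usual; $(S,U)\models\Box_i\varphi$ iff all $S'\in U$ with $S\,\mathcal{E}_i\,S'$ satisfy $(S',U)\models\varphi$; $(S,U)\models\mathsf{A}_i\varphi$ (resp. $\mathsf{R}_i\varphi$) iff every $S'\in U$ with $(S',U)\models\varphi$ has $S\,\mathcal{A}_i\,S'$ (resp. $S\,\mathcal{R}_i\,S'$); $(S,U)\models\mathsf{A}^{\mathsf{real}}_i\varphi$ (resp. $\mathsf{R}^{\mathsf{real}}_i\varphi$) iff every $S'\in U$ with $(S',U)\models\varphi$ and $S\,\mathcal{E}_i\,S'$ has $S\,\mathcal{A}_i\,S'$ (resp. $S\,\mathcal{R}_i\,S'$). $\models\varphi$ means $\varphi$ holds in every model. Abbreviations: $\mathsf{Mot}_i\varphi := \mathsf{A}_i\varphi\wedge\neg\mathsf{R}_i\varphi$; $\mathsf{Demot}_i\varphi := \mathsf{R}_i\varphi\wedge\neg\mathsf{A}_i\varphi$; $\mathsf{Mot}^{\mathsf{real}}_i\varphi := \mathsf{A}^{\mathsf{real}}_i\varphi\wedge\neg\mathsf{R}^{\mathsf{real}}_i\varphi$; $\mathsf{Demot}^{\mathsf{real}}_i\varphi := \mathsf{R}^{\mathsf{real}}_i\varphi\wedge\neg\mathsf{A}^{\mathsf{real}}_i\varphi$.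 Preference: $\psi\prec_i\varphi := (\mathsf{Mot}_i\varphi\wedge\neg\mathsf{Mot}_i\psi)\vee(\mathsf{Demot}_i\psi\wedge\neg\mathsf{Demot}_i\varphi)$ and $\psi\prec^{\mathsf{real}}_i\varphi := (\mathsf{Mot}^{\mathsf{real}}_i\varphi\wedge\neg\mathsf{Mot}^{\mathsf{real}}_i\psi)\vee(\mathsf{Demot}^{\mathsf{real}}_i\psi\wedge\neg\mathsf{Demot}^{\mathsf{real}}_i\varphi)$. -}

module Defs where

open import Data.Nat using (ℕ; suc; _*_)
open import Data.Fin using (Fin; toℕ)
open import Data.Product using (Σ; _×_)
open import Data.Empty using (⊥)
open import Relation.Nullary using (¬_)
open import Level using (Lift; 0ℓ) renaming (suc to lsuc)

Atm : Set
Atm = ℕ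

module _ (n : ℕ) where
  Agt : Set
  Agt = Fin n

  -- distinguished (pairwise distinct) atoms good_i, bad_i
  good : Agt → Atm
  good i = 2 * toℕ i

  bad : Agt → Atm
  bad i = suc (2 * toℕ i)

  data L₀ : Set where
    atom : Atm → L₀
    neg₀ : L₀ → L₀
    and₀ : L₀ → L₀ → L₀
    tri  : Agt → L₀ → L₀

  imp₀ : L₀ → L₀ → L₀
  imp₀ α β = neg₀ (and₀ α (neg₀ β))

  -- states S = ((B_i)_i, V), with B_i ⊆ L₀ and V ⊆ Atm (arbitrary subsets as predicates)
  record State : Set₁ where
    field
      B : Agt → L₀ → Set
      V : Atm → Set
  open State public

  _⊨₀_ : State → L₀ → Set
  S ⊨₀ atom p     = V S p
  S ⊨₀ neg₀ α     = ¬ (S ⊨₀ α)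
  S ⊨₀ and₀ α β   = (S ⊨₀ α) × (S ⊨₀ β)
  S ⊨₀ tri i α    = B S i α

  E : Agt → State → State → Set
  E i S S' = ∀ α → B S i α → S' ⊨₀ α

  Att : Agt → State → State → Set
  Att i S S' = Σ L₀ λ α → B S i (imp₀ α (atom (good i))) × (S' ⊨₀ α)

  Rep : Agt → State → State → Set
  Rep i S S' = Σ L₀ λ α → B S i (imp₀ α (atom (bad i))) × (S' ⊨₀ α)

  data L : Set where
    base  : L₀ → L
    neg   : L → L
    and   : L → L → L
    box   : Agt → L → L
    A     : Agt → L → L
    R     : Agt → L → L
    Areal : Agt → L → L
    Rreal : Agt → L → L

  imp : L → L → L
  imp φ ψ = neg (and φ (neg ψ))

  or : L → L → L
  or φ ψ = neg (and (neg φ) (neg ψ))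

  Sat : State → (State → Set) → L → Set₁
  Sat S U (base α)    = Lift (lsuc 0ℓ) (S ⊨₀ α)
  Sat S U (neg φ)     = ¬ Sat S U φ
  Sat S U (and φ ψ)   = Sat S U φ × Sat S U ψ
  Sat S U (box i φ)   = ∀ S' → U S' → E i S S' → Sat S' U φ
  Sat S U (A i φ)     = ∀ S' → U S' → Sat S' U φ → Lift (lsuc 0ℓ) (Att i S S')
  Sat S U (R i φ)     = ∀ S' → U S' → Sat S' U φ → Lift (lsuc 0ℓ) (Rep i S S')
  Sat S U (Areal i φ) = ∀ S' → U S' → Sat S' U φ → E i S S' → Lift (lsuc 0ℓ) (Att i S S')
  Sat S U (Rreal i φ) = ∀ S' → U S' → Sat S' U φ → E i S S' → Lift (lsuc 0ℓ) (Rep i S S')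

  Valid : L → Set₁
  Valid φ = ∀ (S : State) (U : State → Set) → U S → Sat S U φ

  Mot Demot Motreal Demotreal : Agt → L → L
  Mot i φ       = and (A i φ) (neg (R i φ))
  Demot i φ     = and (R i φ) (neg (A i φ))
  Motreal i φ   = and (Areal i φ) (neg (Rreal i φ))
  Demotreal i φ = and (Rreal i φ) (neg (Areal i φ))

  prec : Agt → L → L → L
  prec i ψ φ = or (and (Mot i φ) (neg (Mot i ψ))) (and (Demot i ψ) (neg (Demot i φ)))

  precreal : Agt → L → L → L
  precreal i ψ φ = or (and (Motreal i φ) (neg (Motreal i ψ))) (and (Demotreal i ψ) (neg (Demotreal i φ)))

data PrefKind : Set where
  ideal real : PrefKind

pref : (n : ℕ) → PrefKind → Agt n → L n → L n → L n
pref n ideal = prec n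
pref n real  = precreal n

{-# OPTIONS --safe #-}
-- Classically, ψ ◁ φ says that ψ ranks strictly below φ in the three-point order
-- demotivating < neutral < motivating, where the rank of a formula depends only on whether
-- the agent is attracted and/or repelled by it; so ◁ is the strict order induced by a rank
-- function. Constructively, u ≺ v amounts to: u is not motivating, v is not demotivating,
-- and not not (v is motivating or u is demotivating); these three facts yield all three laws.
module Submission where

open import Defs
open import Data.Nat using (ℕ)
open import Data.Product using (_×_; _,_)
open import Data.Sum using (_⊎_; inj₁; inj₂; [_,_]; map₂)
open import Function using (id; _∘_)
open import Level using (Level; 0ℓ) renaming (suc to lsuc)
open import Relation.Binary.Definitions using (Irreflexive; Asymmetric; Transitive)
open import Relation.Binary.PropositionalEquality using (_≡_; refl; sym; subst)
open import Relation.Nullary using (¬_)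
open import Relation.Nullary.Negation using (contradiction; ¬¬-map)

record Valence (ℓ : Level) : Set (lsuc ℓ) where
  constructor valence
  field
    attracted repelled : Set ℓ

module _ {ℓ : Level} where
  open Valence

  Motivated Demotivated : Valence ℓ → Set ℓ
  Motivated   v = attracted v × ¬ repelled v
  Demotivated v = repelled v × ¬ attracted v

  _≺_ : Valence ℓ → Valence ℓ → Set ℓ
  u ≺ v = ¬ (¬ (Motivated v × ¬ Motivated u) × ¬ (Demotivated u × ¬ Demotivated v))

  Motivated⇒¬Demotivated : ∀ {v} → Motivated v → ¬ Demotivated v
  Motivated⇒¬Demotivated (_ , ¬r) (r , _) = ¬r r

  ≺⇒¬Motivatedˡ : ∀ {u v} → u ≺ v → ¬ Motivated u
  ≺⇒¬Motivatedˡ u≺v mu =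
    u≺v ((λ (_ , ¬mu) → ¬mu mu) , (λ (du , _) → Motivated⇒¬Demotivated mu du))

  ≺⇒¬Demotivatedʳ : ∀ {u v} → u ≺ v → ¬ Demotivated v
  ≺⇒¬Demotivatedʳ u≺v dv =
    u≺v ((λ (mv , _) → Motivated⇒¬Demotivated mv dv) , (λ (_ , ¬dv) → ¬dv dv))

  ≺⇒¬¬Motivatedʳ⊎Demotivatedˡ : ∀ {u v} → u ≺ v → ¬ ¬ (Motivated v ⊎ Demotivated u)
  ≺⇒¬¬Motivatedʳ⊎Demotivatedˡ u≺v ¬either =
    u≺v ((λ (mv , _) → ¬either (inj₁ mv)) , (λ (du , _) → ¬either (inj₂ du)))

  ≺-intro : ∀ {u v} → ¬ Motivated u → ¬ Demotivated v →
            ¬ ¬ (Motivated v ⊎ Demotivated u) → u ≺ v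
  ≺-intro ¬mu ¬dv ¬¬either (¬motivates , ¬demotivates) =
    ¬¬either [ (λ mv → ¬motivates (mv , ¬mu)) , (λ du → ¬demotivates (du , ¬dv)) ]

  ≺-irrefl : Irreflexive _≡_ _≺_
  ≺-irrefl refl v≺v =
    ≺⇒¬¬Motivatedʳ⊎Demotivatedˡ v≺v [ ≺⇒¬Motivatedˡ v≺v , ≺⇒¬Demotivatedʳ v≺v ]

  ≺-asym : Asymmetric _≺_
  ≺-asym u≺v v≺u =
    ≺⇒¬¬Motivatedʳ⊎Demotivatedˡ u≺v [ ≺⇒¬Motivatedˡ v≺u , ≺⇒¬Demotivatedʳ v≺u ]

  ≺-trans : Transitive _≺_
  ≺-trans u≺v v≺w = ≺-intro (≺⇒¬Motivatedˡ u≺v) (≺⇒¬Demotivatedʳ v≺w)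
    (¬¬-map (map₂ (λ dv → contradiction dv (≺⇒¬Demotivatedʳ u≺v)))
            (≺⇒¬¬Motivatedʳ⊎Demotivatedˡ v≺w))

attraction repulsion : {n : ℕ} → PrefKind → Agt n → L n → L n
attraction ideal = A
attraction real  = Areal
repulsion  ideal = R
repulsion  real  = Rreal

valenceAt : {n : ℕ} → PrefKind → Agt n → State n → (State n → Set) → L n → Valence (lsuc 0ℓ)
valenceAt {n} k i S U φ = valence (Sat n S U (attraction k i φ)) (Sat n S U (repulsion k i φ))

Sat-pref≡≺ : {n : ℕ} (k : PrefKind) (i : Agt n) (S : State n) (U : State n → Set) (ψ φ : L n) →
             Sat n S U (pref n k i ψ φ) ≡ (valenceAt k i S U ψ ≺ valenceAt k i S U φ)
Sat-pref≡≺ ideal i S U ψ φ = refl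
Sat-pref≡≺ real  i S U ψ φ = refl

module _ {n : ℕ} (k : PrefKind) (i : Agt n) (S : State n) (U : State n → Set) where

  _◁_ : L n → L n → Set₁
  ψ ◁ φ = Sat n S U (pref n k i ψ φ)

  ◁⇒≺ : ∀ {ψ φ} → ψ ◁ φ → valenceAt k i S U ψ ≺ valenceAt k i S U φ
  ◁⇒≺ {ψ} {φ} = subst id (Sat-pref≡≺ k i S U ψ φ)

  ≺⇒◁ : ∀ {ψ φ} → valenceAt k i S U ψ ≺ valenceAt k i S U φ → ψ ◁ φ
  ≺⇒◁ {ψ} {φ} = subst id (sym (Sat-pref≡≺ k i S U ψ φ))

  ◁-irrefl : ∀ {φ} → ¬ (φ ◁ φ)
  ◁-irrefl = ≺-irrefl refl ∘ ◁⇒≺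

  ◁-asym : Asymmetric _◁_
  ◁-asym ψ◁φ φ◁ψ = ≺-asym (◁⇒≺ ψ◁φ) (◁⇒≺ φ◁ψ)

  ◁-trans : Transitive _◁_
  ◁-trans φ₁◁φ₂ φ₂◁φ₃ = ≺⇒◁ (≺-trans (◁⇒≺ φ₁◁φ₂) (◁⇒≺ φ₂◁φ₃))

proposition2 : (n : ℕ) (i : Agt n) (k : PrefKind) (φ ψ φ₁ φ₂ φ₃ : L n) →
    Valid n (neg (pref n k i φ φ))
    × Valid n (imp n (pref n k i ψ φ) (neg (pref n k i φ ψ)))
    × Valid n (imp n (and (pref n k i φ₁ φ₂) (pref n k i φ₂ φ₃)) (pref n k i φ₁ φ₃))
proposition2 n i k φ ψ φ₁ φ₂ φ₃ =
    (λ S U _ → ◁-irrefl k i S U)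
  , (λ S U _ (ψ◁φ , ¬¬φ◁ψ) → ¬¬φ◁ψ (◁-asym k i S U ψ◁φ))
  , (λ S U _ ((φ₁◁φ₂ , φ₂◁φ₃) , ¬φ₁◁φ₃) → ¬φ₁◁φ₃ (◁-trans k i S U φ₁◁φ₂ φ₂◁φ₃))
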